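{- Let $\ell$ have binary power representation $\ell=\sum_{i=1}^k 2^{n_i}$ with $n_1>\cdots>n_k\ge0$, and let $T_{\mathbf L}$ be the tree defined below, with path vertices $v_1,\dots,v_k$ and, for $1\le i\le k$, $c_i$ the root of the complete binary tree on $2^{n_i}$ leaves (so $c_1=v_1$ and $c_i$ is the child of $v_i$ off the path for $i\ge2$). Fix $i\in\{2,\dots,k-1\}$ with $n_i=n_{i+1}+1$. Then: (1) $R(T_{\mathbf L})=R(T^*)$ where $T^*=T_{\mathbf L}-v_{i+1}c_{i+1}-v_ic_i+v_{i+1}c_i+v_ic_{i+1}$; (2) $R(T_{\mathbf L})=R(T^*)$ where $T^*=T_{\mathbf L}-v_{i+1}c_{i+1}-v_iv_{i-1}+v_{i-1}v_{i+1}+v_ic_{i+1}$. (In both cases $T^*$ is rooted at $v_k$.)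
   Context: All trees are rooted; $T(v)$ is the subtree induced by $v$ and its descendants; a leaf is a vertex with no children. The rank $R_T(v)$ is the minimum distance from $v$ to a leaf of $T(v)$, and the security is $R(T)=\sum_{v}R_T(v)$. A complete binary tree on $2^m$ leaves is the rooted tree in which every non-leaf vertex has exactly two children and all $2^m$ leaves are at distance $m$ from the root. The tree $T_{\mathbf L}$ is rooted at $v_k$ and constructed by taking a path $v_1v_2\cdots v_k$, identifying $v_1$ with the root of a complete binary tree on $2^{n_1}$ leaves, and for each $2\le i\le k$ joining $v_i$ by an edge to the root $c_i$ of a new complete binary tree on $2^{n_i}$ leaves. -}

module Defs where

open import Data.Nat using (ℕ; zero; suc; _+_; _^_; _⊓_; _∸_)
open import Data.List using (List; []; _∷_)

data Tree : Set where
  node : List Tree → Tree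

mutual
  rank : Tree → ℕ
  rank (node [])       = 0
  rank (node (t ∷ ts)) = suc (minRank t ts)

  minRank : Tree → List Tree → ℕ
  minRank t []        = rank t
  minRank t (u ∷ us)  = rank t ⊓ minRank u us

mutual
  -- Security R(T) = sum over all vertices v of R_T(v).
  security : Tree → ℕ
  security (node ts) = rank (node ts) + securities ts

  securities : List Tree → ℕ
  securities []       = 0
  securities (t ∷ ts) = security t + securities ts

cbt : ℕ → Tree
cbt zero    = node []
cbt (suc m) = node (cbt m ∷ cbt m ∷ [])

sumPow : (ℕ → ℕ) → ℕ → ℕ
sumPow n zero    = 0
sumPow n (suc j) = sumPow n j + 2 ^ n (suc j)

-- Exponents are 1-indexed: n 1, ..., n k.
-- P n j is the subtree T_L(v_j) rooted at path vertex v_j (for j ≥ 1):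
--   v_1 = c_1 is the root of cbt (n 1);
--   v_j (j ≥ 2) has children v_{j-1} and c_j (root of cbt (n j)).
-- (P n 0 is a dummy value, never used.)
P : (ℕ → ℕ) → ℕ → Tree
P n zero          = node []
P n (suc zero)    = cbt (n 1)
P n (suc (suc j)) = node (P n (suc j) ∷ cbt (n (suc (suc j))) ∷ [])

TL : (ℕ → ℕ) → ℕ → Tree
TL n k = P n k

above : (ℕ → ℕ) → Tree → ℕ → ℕ → Tree
above n t j zero    = t
above n t j (suc m) = above n (node (t ∷ cbt (n (suc j)) ∷ [])) (suc j) m

-- (1) T* = T_L - v_{i+1}c_{i+1} - v_i c_i + v_{i+1} c_i + v_i c_{i+1}:
--   v_i now has children v_{i-1}, c_{i+1}; v_{i+1} has children v_i, c_i.
Tstar1 : (ℕ → ℕ) → ℕ → ℕ → Tree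
Tstar1 n k i =
  above n
    (node (node (P n (i ∸ 1) ∷ cbt (n (suc i)) ∷ []) ∷ cbt (n i) ∷ []))
    (suc i) (k ∸ suc i)

-- (2) T* = T_L - v_{i+1}c_{i+1} - v_i v_{i-1} + v_{i-1} v_{i+1} + v_i c_{i+1}:
--   v_i now has children c_i, c_{i+1}; v_{i+1} has children v_i, v_{i-1}.
Tstar2 : (ℕ → ℕ) → ℕ → ℕ → Tree
Tstar2 n k i =
  above n
    (node (node (cbt (n i) ∷ cbt (n (suc i)) ∷ []) ∷ P n (i ∸ 1) ∷ []))
    (suc i) (k ∸ suc i)

{-# OPTIONS --safe #-}
-- In T_L the path vertices v_i and v_{i+1} carry the three subtrees T(v_{i-1}),
-- T(c_i) and T(c_{i+1}), of ranks > a, a + 1 and a where a = n_{i+1}.  In each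
-- of the three arrangements of these subtrees under v_i and v_{i+1}, the two
-- path vertices get the ranks a + 1 and a + 2 in some order, so the sum of
-- ranks is unchanged.  Above v_{i+1} nothing changes either: every later v_j
-- has rank 1 + n_j, because its complete binary branch is the shallower one.
module Submission where

open import Defs
open import Data.Nat using (ℕ; zero; suc; _<_; _≤_; _+_; _⊓_; _∸_; s≤s; z≤n)
open import Data.Nat.Properties
open import Data.Nat.Solver using (module +-*-Solver)
open import Data.Product using (_×_; _,_; proj₂)
open import Data.List using ([]; _∷_)
open import Relation.Binary.PropositionalEquality
open +-*-Solver using (solve; _:+_; _:=_; con)

infixl 6 _⋏_
infix 4 _≈_

_⋏_ : Tree → Tree → Tree
t ⋏ u = node (t ∷ u ∷ [])

_≈_ : Tree → Tree → Set
t ≈ u = rank t ≡ rank u × security t ≡ security u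

StrictlyDecreasing : (ℕ → ℕ) → ℕ → Set
StrictlyDecreasing n k = ∀ j → 1 ≤ j → j < k → n (suc j) < n j

rank-cbt : ∀ m → rank (cbt m) ≡ m
rank-cbt zero    = refl
rank-cbt (suc m) rewrite rank-cbt m = cong suc (⊓-idem m)

rank-⋏-≤ʳ : ∀ t u {x y} → rank t ≡ x → rank u ≡ y → y ≤ x → rank (t ⋏ u) ≡ suc y
rank-⋏-≤ʳ t u refl refl y≤x = cong suc (m≥n⇒m⊓n≡n y≤x)

rank-⋏-≤ˡ : ∀ t u {x y} → rank t ≡ x → rank u ≡ y → x ≤ y → rank (t ⋏ u) ≡ suc x
rank-⋏-≤ˡ t u refl refl x≤y = cong suc (m≤n⇒m⊓n≡m x≤y)

rank-⋏-cbt : ∀ t {b} → b ≤ rank t → rank (t ⋏ cbt b) ≡ suc b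
rank-⋏-cbt t {b} = rank-⋏-≤ʳ t (cbt b) refl (rank-cbt b)

security-⋏ : ∀ t u → security (t ⋏ u) ≡ rank (t ⋏ u) + (security t + security u)
security-⋏ t u = cong (λ x → rank (t ⋏ u) + (security t + x)) (+-identityʳ (security u))

security-⋏-⋏ : ∀ {A B C r r′} → rank (A ⋏ B ⋏ C) ≡ r → rank (A ⋏ B) ≡ r′ →
  security (A ⋏ B ⋏ C) ≡ r + r′ + (security A + security B + security C)
security-⋏-⋏ {A} {B} {C} refl refl = solve 5
  (λ r r′ a b c → r :+ ((r′ :+ (a :+ (b :+ con 0))) :+ (c :+ con 0))
               := r :+ r′ :+ (a :+ b :+ c))
  refl (rank (A ⋏ B ⋏ C)) (rank (A ⋏ B)) (security A) (security B) (security C)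

⋏-congˡ-security : ∀ {t t′} u → rank (t ⋏ u) ≡ rank (t′ ⋏ u) → security t ≡ security t′ →
                   t ⋏ u ≈ t′ ⋏ u
⋏-congˡ-security {t} {t′} u r s = r , (begin
  security (t ⋏ u)                          ≡⟨ security-⋏ t u ⟩
  rank (t ⋏ u) + (security t + security u)   ≡⟨ cong₂ (λ x y → x + (y + security u)) r s ⟩
  rank (t′ ⋏ u) + (security t′ + security u) ≡⟨ security-⋏ t′ u ⟨
  security (t′ ⋏ u)                         ∎)
  where open ≡-Reasoning

⋏-congˡ : ∀ {t t′} u → t ≈ t′ → t ⋏ u ≈ t′ ⋏ u
⋏-congˡ u (r , s) = ⋏-congˡ-security u (cong (λ x → suc (x ⊓ rank u)) r) s

⋏-cbt-cong : ∀ {t t′ b} → b ≤ rank t → b ≤ rank t′ → security t ≡ security t′ →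
             t ⋏ cbt b ≈ t′ ⋏ cbt b
⋏-cbt-cong {t} {t′} {b} b≤t b≤t′ =
  ⋏-congˡ-security (cbt b) (trans (rank-⋏-cbt t b≤t) (sym (rank-⋏-cbt t′ b≤t′)))

above-cong : ∀ n {t t′} j m → t ≈ t′ → above n t j m ≈ above n t′ j m
above-cong n j zero    t≈t′ = t≈t′
above-cong n j (suc m) t≈t′ = above-cong n (suc j) m (⋏-congˡ (cbt (n (suc j))) t≈t′)

security-above-cong : ∀ {n t t′} j m → StrictlyDecreasing n (suc j + m) →
  n (suc j) ≤ rank t → n (suc j) ≤ rank t′ → security t ≡ security t′ →
  security (above n t (suc j) m) ≡ security (above n t′ (suc j) m)
security-above-cong j zero    _   _   _    s = s
security-above-cong {n} j (suc m) dec j≤t j≤t′ s =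
  proj₂ (above-cong n (suc (suc j)) m (⋏-cbt-cong (≤-trans next≤j j≤t) (≤-trans next≤j j≤t′) s))
  where
  next≤j : n (suc (suc j)) ≤ n (suc j)
  next≤j = <⇒≤ (dec (suc j) (s≤s z≤n) (m<m+n (suc j) (s≤s z≤n)))

P-above : ∀ n j m → above n (P n (suc j)) (suc j) m ≡ P n (suc j + m)
P-above n j zero    = cong (P n) (sym (+-identityʳ (suc j)))
P-above n j (suc m) = trans (P-above n (suc j) m) (cong (P n) (sym (+-suc (suc j) m)))

n≤rank-P : ∀ {n k} → StrictlyDecreasing n k → ∀ j → j < k → n (suc j) ≤ rank (P n (suc j))
n≤rank-P {n} dec zero    _   = ≤-reflexive (sym (rank-cbt (n 1)))
n≤rank-P {n} dec (suc j) j<k =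
  ≤-trans (n≤1+n _) (≤-reflexive (sym (rank-⋏-cbt (P n (suc j)) next≤P)))
  where
  next≤P : n (suc (suc j)) ≤ rank (P n (suc j))
  next≤P = ≤-trans (<⇒≤ (dec (suc j) (s≤s z≤n) j<k)) (n≤rank-P dec j (<-trans (n<1+n j) j<k))

-- X ⋏ Y ⋏ Z is T_L(v_{i+1}); X ⋏ Z ⋏ Y and Y ⋏ Z ⋏ X are the two T*(v_{i+1}).
module Swap {X Y Z : Tree} {a : ℕ} (a<X : a < rank X) (Y≡ : rank Y ≡ suc a) (Z≡ : rank Z ≡ a) where

  private
    rank-XY : rank (X ⋏ Y) ≡ suc (suc a)
    rank-XY = rank-⋏-≤ʳ X Y refl Y≡ a<X

    rank-XZ : rank (X ⋏ Z) ≡ suc a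
    rank-XZ = rank-⋏-≤ʳ X Z refl Z≡ (<⇒≤ a<X)

    rank-YZ : rank (Y ⋏ Z) ≡ suc a
    rank-YZ = rank-⋏-≤ʳ Y Z Y≡ Z≡ (n≤1+n a)

  rank-XYZ : rank (X ⋏ Y ⋏ Z) ≡ suc a
  rank-XYZ = rank-⋏-≤ʳ (X ⋏ Y) Z rank-XY Z≡ (≤-trans (n≤1+n a) (n≤1+n (suc a)))

  rank-XZY : rank (X ⋏ Z ⋏ Y) ≡ suc (suc a)
  rank-XZY = rank-⋏-≤ʳ (X ⋏ Z) Y rank-XZ Y≡ ≤-refl

  rank-YZX : rank (Y ⋏ Z ⋏ X) ≡ suc (suc a)
  rank-YZX = rank-⋏-≤ˡ (Y ⋏ Z) X rank-YZ refl a<X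

  security-XZY : security (X ⋏ Y ⋏ Z) ≡ security (X ⋏ Z ⋏ Y)
  security-XZY = trans (security-⋏-⋏ rank-XYZ rank-XY)
    (trans (solve 4 (λ a x y z → (con 1 :+ a) :+ (con 2 :+ a) :+ (x :+ y :+ z)
                              := (con 2 :+ a) :+ (con 1 :+ a) :+ (x :+ z :+ y))
                    refl a (security X) (security Y) (security Z))
           (sym (security-⋏-⋏ rank-XZY rank-XZ)))

  security-YZX : security (X ⋏ Y ⋏ Z) ≡ security (Y ⋏ Z ⋏ X)
  security-YZX = trans (security-⋏-⋏ rank-XYZ rank-XY)
    (trans (solve 4 (λ a x y z → (con 1 :+ a) :+ (con 2 :+ a) :+ (x :+ y :+ z)
                              := (con 2 :+ a) :+ (con 1 :+ a) :+ (y :+ z :+ x))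
                    refl a (security X) (security Y) (security Z))
           (sym (security-⋏-⋏ rank-YZX rank-YZ)))

proposition2p10 :
    (ℓ k : ℕ) (n : ℕ → ℕ) →
    (∀ j → 1 ≤ j → j < k → n (suc j) < n j) →
    ℓ ≡ sumPow n k →
    (i : ℕ) → 2 ≤ i → i < k → n i ≡ suc (n (suc i)) →
    (security (TL n k) ≡ security (Tstar1 n k i))
      × (security (TL n k) ≡ security (Tstar2 n k i))
-- ℓ ≡ sumPow n k only names ℓ; the binary expansion is used through dec.
proposition2p10 ℓ k n dec _ (suc (suc i)) (s≤s (s≤s _)) I<k nI≡ with m≤n⇒∃[o]m+o≡n I<k
... | m , refl = swapped (a≤ 2 rank-XZY) security-XZY , swapped (a≤ 2 rank-YZX) security-YZX
  where
  I = suc (suc i)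
  a = n (suc I)

  1+i<k : suc i < suc I + m
  1+i<k = <-trans (n<1+n (suc i)) I<k

  a<rank-P : a < rank (P n (suc i))
  a<rank-P = ≤-trans (≤-reflexive (sym nI≡)) (≤-trans (<⇒≤ (dec (suc i) (s≤s z≤n) 1+i<k))
                                                       (n≤rank-P dec i (<-trans (n<1+n i) 1+i<k)))

  open Swap a<rank-P (trans (rank-cbt (n I)) nI≡) (rank-cbt a)

  a≤ : ∀ {r} d → r ≡ d + a → a ≤ r
  a≤ d r = ≤-trans (m≤n+m a d) (≤-reflexive (sym r))

  swapped : ∀ {S} → a ≤ rank S → security (P n (suc I)) ≡ security S →
            security (TL n (suc I + m)) ≡ security (above n S (suc I) (suc I + m ∸ suc I))
  swapped a≤S sS rewrite m+n∸m≡n i m =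
    trans (cong security (sym (P-above n I m))) (security-above-cong I m dec (a≤ 1 rank-XYZ) a≤S sS)
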